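{- For a primitive word $T$ over a totally ordered alphabet, the Galois rotation of $T$ can be computed in $O(|T|)$ time and $O(1)$ additional working space.
   Context: A word is primitive if it is not of the form $U^k$ with $k\ge2$. Alternating order: for words $S,T$ with $S^\omega\neq T^\omega$ ($X^\omega$ is the infinite repetition of $X$), let $j$ be the first position with $S^\omega[j]\neq T^\omega[j]$; then $S\prec_{\mathrm{alt}}T$ if either $j$ is odd and $S^\omega[j]<T^\omega[j]$, or $j$ is even and $S^\omega[j]>T^\omega[j]$. A word is Galois if it is strictly smaller with respect to $\prec_{\mathrm{alt}}$ than all its other cyclic rotations. For a primitive word $W=UV$, the rotation $VU$ is the Galois rotation of $W$ if $VU$ is Galois. The model is the word RAM with read-only input and constant-time symbol comparisons. -}

module Defs where

open import Data.Nat using (ℕ; zero; suc; _+_; _*_; _∸_; _≤_; _<_; _%_; _/_)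
open import Data.Fin using (Fin)
open import Data.List using (List; []; _∷_; length; concat; replicate; drop; take; _++_)
open import Data.Maybe using (Maybe; just; nothing)
open import Data.Product using (∃; _×_; _,_)
open import Data.Sum using (_⊎_)
open import Data.Empty using (⊥)
open import Relation.Nullary using (¬_)
open import Relation.Binary.PropositionalEquality using (_≡_)
open import Relation.Binary.Structures using (IsStrictTotalOrder)
open import Relation.Binary.Definitions using (Tri; tri<; tri≈; tri>)

pow : {A : Set} → List A → ℕ → List A
pow U k = concat (replicate k U)

Primitive : {A : Set} → List A → Set
Primitive {A} W = (U : List A) (k : ℕ) → 2 ≤ k → ¬ (W ≡ pow U k)

rotate : {A : Set} → ℕ → List A → List A
rotate i W = drop i W ++ take i W

index : {A : Set} → List A → ℕ → Maybe A
index []       _       = nothing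
index (x ∷ xs) zero    = just x
index (x ∷ xs) (suc i) = index xs i

-- (x ∷ xs)^ω at 0-based position p, i.e. (x ∷ xs)[p mod |x ∷ xs|]
omegaAt : {A : Set} → A → List A → ℕ → A
omegaAt x xs p with index (x ∷ xs) (p % suc (length xs))
... | just a  = a
... | nothing = x   -- never happens

-- Alternating order (positions here are 0-based: the paper's 1-based
-- position j is p + 1, so "j odd" is "p even").
module Alt {A : Set} (_<ₐ_ : A → A → Set) where

  _≺alt_ : List A → List A → Set
  []       ≺alt _        = ⊥
  (_ ∷ _)  ≺alt []       = ⊥
  (x ∷ xs) ≺alt (y ∷ ys) =
    ∃ λ p → ((q : ℕ) → q < p → omegaAt x xs q ≡ omegaAt y ys q)
          × ( (p % 2 ≡ 0 × omegaAt x xs p <ₐ omegaAt y ys p)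
            ⊎ (p % 2 ≡ 1 × omegaAt y ys p <ₐ omegaAt x xs p))

  Galois : List A → Set
  Galois W = (i : ℕ) → 0 < i → i < length W → ¬ (rotate i W ≡ W) → W ≺alt rotate i W

-- Word RAM with read-only input, constant-time symbol comparisons,
-- and k registers (the working space).  Registers hold natural numbers;
-- the word-size restriction (O(log n)-bit words) is imposed in the
-- theorem by bounding every register value by (n+2)^e.

data Instr (k : ℕ) : Set where
  const : Fin k → ℕ → Instr k
  len   : Fin k → Instr k
  add   : Fin k → Fin k → Fin k → Instr k
  sub   : Fin k → Fin k → Fin k → Instr k
  mul   : Fin k → Fin k → Fin k → Instr k
  div   : Fin k → Fin k → Fin k → Instr k     -- r := a / b  (0 if b = 0)
  mod   : Fin k → Fin k → Fin k → Instr k     -- r := a % b  (0 if b = 0)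
  jmp   : ℕ → Instr k
  jlt   : Fin k → Fin k → ℕ → Instr k
  jeq   : Fin k → Fin k → ℕ → Instr k
  cmp   : Fin k → Fin k → ℕ → ℕ → ℕ → Instr k
  halt  : Fin k → Instr k

Program : ℕ → Set
Program k = List (Instr k)

Regs : ℕ → Set
Regs k = Fin k → ℕ

record Config (k : ℕ) : Set where
  constructor cfg
  field
    pc   : ℕ
    regs : Regs k

data Result (k : ℕ) : Set where
  done  : ℕ → Result k
  crash : Result k
  next  : Config k → Result k

initial : {k : ℕ} → Config k
initial = cfg 0 (λ _ → 0)

private
  update : {k : ℕ} → Regs k → Fin k → ℕ → Regs k
  update R r v i with Data.Fin._≟_ r i
  ... | Relation.Nullary.yes _ = v
  ... | Relation.Nullary.no _  = R i

  safeDiv : ℕ → ℕ → ℕ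
  safeDiv a zero    = 0
  safeDiv a (suc b) = a / suc b

  safeMod : ℕ → ℕ → ℕ
  safeMod a zero    = 0
  safeMod a (suc b) = a % suc b

  fetch : {k : ℕ} → Program k → ℕ → Maybe (Instr k)
  fetch = index

module Machine {A : Set} {_<ₐ_ : A → A → Set}
               (sto : IsStrictTotalOrder _≡_ _<ₐ_) where

  open IsStrictTotalOrder sto using (compare)

  exec : {k : ℕ} → List A → Config k → Instr k → Result k
  exec T (cfg p R) (const r c)  = next (cfg (suc p) (update R r c))
  exec T (cfg p R) (len r)      = next (cfg (suc p) (update R r (length T)))
  exec T (cfg p R) (add r a b)  = next (cfg (suc p) (update R r (R a + R b)))
  exec T (cfg p R) (sub r a b)  = next (cfg (suc p) (update R r (R a ∸ R b)))
  exec T (cfg p R) (mul r a b)  = next (cfg (suc p) (update R r (R a * R b)))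
  exec T (cfg p R) (div r a b)  = next (cfg (suc p) (update R r (safeDiv (R a) (R b))))
  exec T (cfg p R) (mod r a b)  = next (cfg (suc p) (update R r (safeMod (R a) (R b))))
  exec T (cfg p R) (jmp t)      = next (cfg t R)
  exec T (cfg p R) (jlt a b t) with Data.Nat._<?_ (R a) (R b)
  ... | Relation.Nullary.yes _ = next (cfg t R)
  ... | Relation.Nullary.no _  = next (cfg (suc p) R)
  exec T (cfg p R) (jeq a b t) with Data.Nat._≟_ (R a) (R b)
  ... | Relation.Nullary.yes _ = next (cfg t R)
  ... | Relation.Nullary.no _  = next (cfg (suc p) R)
  exec T (cfg p R) (cmp a b t₁ t₂ t₃) with index T (R a) | index T (R b)
  ... | just x | just y with compare x y
  ...   | tri< _ _ _ = next (cfg t₁ R)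
  ...   | tri≈ _ _ _ = next (cfg t₂ R)
  ...   | tri> _ _ _ = next (cfg t₃ R)
  exec T (cfg p R) (cmp a b t₁ t₂ t₃) | _ | _ = crash
  exec T (cfg p R) (halt r)     = done (R r)

  step : {k : ℕ} → Program k → List A → Config k → Result k
  step P T c with fetch P (Config.pc c)
  ... | just ins = exec T c ins
  ... | nothing  = crash

  RegsBounded : {k : ℕ} → ℕ → Config k → Set
  RegsBounded B c = (i : _) → Config.regs c i ≤ B

  data Runs {k : ℕ} (P : Program k) (T : List A) (B : ℕ) :
            ℕ → Config k → ℕ → Set where
    stop : ∀ {c o} → step P T c ≡ done o → RegsBounded B c → Runs P T B 1 c o
    go   : ∀ {c c' t o} → step P T c ≡ next c' → RegsBounded B c →
           Runs P T B t c' o → Runs P T B (suc t) c o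

{-# OPTIONS --safe #-}
-- A rotation of T that is least in the alternating order is Galois, so it suffices to find one in
-- constant space.  Dropping an even number of letters from two infinite words keeps the parity of
-- every position, hence their alternating comparison; so among the rotations of T^ω starting at the
-- positions c + 2u of one parity c, the order is lexicographic on blocks of two letters (the first
-- compared upwards, the second downwards).  The classical two-pointer minimal-rotation search thus
-- works within each parity class: if candidates u₁ and u₂ agree on k blocks and u₁ loses on the next
-- one, then each u₁ + l with l ≤ k is beaten by u₂ + l, and u₁ may jump to u₁ + k + 1.  Every round
-- increases u₁ + u₂ + k, which stays below 3n, so the search is linear; the two class winners are
-- finally compared letter by letter.
module Submission where

open import Defs
open import Data.Nat using (ℕ; zero; suc; pred; _+_; _*_; _^_; _∸_; _⊓_; _/_; _%_; _≤_; _<_; _≟_; _<?_)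
open import Data.Nat using (z≤n; s≤s; z<s; NonZero; >-nonZero⁻¹)
open import Data.Nat.Properties
open import Data.Nat.DivMod
open import Data.Fin using (Fin; #_)
open import Data.List using (List; []; _∷_; length; drop; take; _++_)
open import Data.List.Properties using (length-++; length-drop; length-take)
open import Data.Maybe using (just)
open import Data.Maybe.Properties using (just-injective)
open import Data.Product using (∃; _×_; Σ; _,_; proj₁; proj₂)
open import Data.Sum using (_⊎_; inj₁; inj₂)
open import Data.Empty using (⊥-elim)
open import Relation.Nullary using (¬_; yes; no)
open import Relation.Nullary.Decidable using (True; toWitness)
open import Relation.Binary.PropositionalEquality
open import Relation.Binary.Structures using (IsStrictTotalOrder)
open import Relation.Binary.Definitions using (tri<; tri≈; tri>)
open import Function using (_∘_)
open import Data.Nat.Solver using (module +-*-Solver)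
open +-*-Solver using (solve; _:+_; _:*_; _:=_; con)

private variable
  A : Set

-- Infinite words

infixl 8 _↓_

_↓_ : (ℕ → A) → ℕ → (ℕ → A)
(f ↓ m) p = f (m + p)

AgreeBelow : ℕ → (ℕ → A) → (ℕ → A) → Set
AgreeBelow m f g = ∀ q → q < m → f q ≡ g q

Periodic : ℕ → (ℕ → A) → Set
Periodic n f = ∀ p → f (p + n) ≡ f p

↓-↓ : (f : ℕ → A) (m k : ℕ) → f ↓ m ↓ k ≗ f ↓ (m + k)
↓-↓ f m k p = cong f (sym (+-assoc m k p))

agreeBelow-sym : ∀ {m} {f g : ℕ → A} → AgreeBelow m f g → AgreeBelow m g f
agreeBelow-sym ag q q<m = sym (ag q q<m)

agreeBelow-trans : ∀ {m} {f g h : ℕ → A} → AgreeBelow m f g → AgreeBelow m g h → AgreeBelow m f h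
agreeBelow-trans ag ag′ q q<m = trans (ag q q<m) (ag′ q q<m)

agreeBelow-≤ : ∀ {m m′} {f g : ℕ → A} → m ≤ m′ → AgreeBelow m′ f g → AgreeBelow m f g
agreeBelow-≤ m≤m′ ag q q<m = ag q (<-≤-trans q<m m≤m′)

agreeBelow-extend : ∀ {m} {f g : ℕ → A} → AgreeBelow m f g → f m ≡ g m → AgreeBelow (suc m) f g
agreeBelow-extend ag e q q<1+m with m<1+n⇒m<n∨m≡n q<1+m
... | inj₁ q<m = ag q q<m
... | inj₂ refl = e

agreeBelow-↓ : ∀ {f g : ℕ → A} m j → AgreeBelow (m + j) f g → AgreeBelow j (f ↓ m) (g ↓ m)
agreeBelow-↓ m j ag q q<j = ag (m + q) (+-monoʳ-< m q<j)

periodic-+* : ∀ {n} {f : ℕ → A} → Periodic n f → ∀ p j → f (p + j * n) ≡ f p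
periodic-+* {f = f} per p zero = cong f (+-identityʳ p)
periodic-+* {n = n} {f} per p (suc j) = begin
  f (p + (n + j * n)) ≡⟨ cong f (trans (cong (p +_) (+-comm n (j * n))) (sym (+-assoc p (j * n) n))) ⟩
  f (p + j * n + n)   ≡⟨ per (p + j * n) ⟩
  f (p + j * n)       ≡⟨ periodic-+* per p j ⟩
  f p                 ∎
  where open ≡-Reasoning

periodic-% : ∀ {n} .{{_ : NonZero n}} {f : ℕ → A} → Periodic n f → ∀ p → f (p % n) ≡ f p
periodic-% {n = n} {f} per p =
  trans (sym (periodic-+* per (p % n) (p / n))) (cong f (sym (m≡m%n+[m/n]*n p n)))

periodic-↓ : ∀ {n} {f : ℕ → A} → Periodic n f → ∀ m → Periodic n (f ↓ m)
periodic-↓ {n = n} {f} per m p = trans (cong f (sym (+-assoc m p n))) (per (m + p))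

periodic-agreeBelow⇒≗ : ∀ {n} .{{_ : NonZero n}} {f g : ℕ → A} →
                        Periodic n f → Periodic n g → AgreeBelow n f g → f ≗ g
periodic-agreeBelow⇒≗ {n = n} per per′ ag p =
  trans (sym (periodic-% per p)) (trans (ag (p % n) (m%n<n p n)) (periodic-% per′ p))

m%2≡0⊎m%2≡1 : ∀ m → m % 2 ≡ 0 ⊎ m % 2 ≡ 1
m%2≡0⊎m%2≡1 m with m % 2 | m%n<n m 2
... | 0 | _ = inj₁ refl
... | 1 | _ = inj₂ refl
... | suc (suc _) | s≤s (s≤s ())

-- Lists as periods of infinite words

index-++ˡ : ∀ (as bs : List A) q → q < length as → index (as ++ bs) q ≡ index as q
index-++ˡ (a ∷ as) bs zero _ = refl
index-++ˡ (a ∷ as) bs (suc q) (s≤s q<) = index-++ˡ as bs q q<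

index-++ʳ : ∀ (as bs : List A) q → index (as ++ bs) (length as + q) ≡ index bs q
index-++ʳ [] bs q = refl
index-++ʳ (a ∷ as) bs q = index-++ʳ as bs q

index-drop : ∀ (as : List A) i q → index (drop i as) q ≡ index as (i + q)
index-drop as zero q = refl
index-drop [] (suc i) q = refl
index-drop (a ∷ as) (suc i) q = index-drop as i q

index-take : ∀ (as : List A) i q → q < i → index (take i as) q ≡ index as q
index-take [] (suc i) q _ = refl
index-take (a ∷ as) (suc i) zero _ = refl
index-take (a ∷ as) (suc i) (suc q) (s≤s q<i) = index-take as i q q<i

index-just : ∀ (as : List A) q → q < length as → ∃ λ a → index as q ≡ just a
index-just (a ∷ as) zero _ = a , refl
index-just (a ∷ as) (suc q) (s≤s q<) = index-just as q q<

omegaAt-index : ∀ (y : A) ys p → index (y ∷ ys) (p % suc (length ys)) ≡ just (omegaAt y ys p)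
omegaAt-index y ys p with index (y ∷ ys) (p % suc (length ys))
                        | index-just (y ∷ ys) (p % suc (length ys)) (m%n<n p (suc (length ys)))
... | just a | _ = refl

omegaAt-periodic : ∀ (y : A) ys → Periodic (suc (length ys)) (omegaAt y ys)
omegaAt-periodic y ys p = just-injective (begin
  just (omegaAt y ys (p + n)) ≡⟨ omegaAt-index y ys (p + n) ⟨
  index (y ∷ ys) ((p + n) % n) ≡⟨ cong (index (y ∷ ys)) ([m+n]%n≡m%n p n) ⟩
  index (y ∷ ys) (p % n)       ≡⟨ omegaAt-index y ys p ⟩
  just (omegaAt y ys p)        ∎)
  where
    open ≡-Reasoning
    n = suc (length ys)

OnePeriod : ℕ → List A → (ℕ → A) → Set
OnePeriod n as f = length as ≡ n × (∀ q → q < n → index as q ≡ just (f q))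

onePeriod-unique : ∀ {n} {as bs : List A} {f} → OnePeriod n as f → OnePeriod n bs f → as ≡ bs
onePeriod-unique {as = []} {[]} _ _ = refl
onePeriod-unique {as = []} {b ∷ bs} (refl , _) (() , _)
onePeriod-unique {as = a ∷ as} {[]} (refl , _) (() , _)
onePeriod-unique {as = a ∷ as} {b ∷ bs} (refl , idx) (∣bs∣≡n , idx′) =
  cong₂ _∷_ (just-injective (trans (idx 0 z<s) (sym (idx′ 0 z<s))))
            (onePeriod-unique (refl , λ q q< → idx (suc q) (s≤s q<))
                              (suc-injective ∣bs∣≡n , λ q q< → idx′ (suc q) (s≤s q<)))

omegaAt-onePeriod : ∀ {n} {y : A} {ys f} → Periodic n f → OnePeriod n (y ∷ ys) f → omegaAt y ys ≗ f
omegaAt-onePeriod {y = y} {ys} {f} per (refl , idx) p = just-injective (begin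
  just (omegaAt y ys p)  ≡⟨ omegaAt-index y ys p ⟨
  index (y ∷ ys) (p % n) ≡⟨ idx (p % n) (m%n<n p n) ⟩
  just (f (p % n))       ≡⟨ cong just (periodic-% per p) ⟩
  just (f p)             ∎)
  where
    open ≡-Reasoning
    n = suc (length ys)

module _ {as : List A} {i n : ℕ} (∣as∣≡n : length as ≡ n) (i<n : i < n) where

  private
    ∣drop∣≡n∸i : length (drop i as) ≡ n ∸ i
    ∣drop∣≡n∸i = trans (length-drop i as) (cong (_∸ i) ∣as∣≡n)

  length-rotate : length (rotate i as) ≡ n
  length-rotate = trans (length-++ (drop i as)) (trans (cong₂ _+_ ∣drop∣≡n∸i ∣take∣≡i) (m∸n+n≡m (<⇒≤ i<n)))
    where
      ∣take∣≡i : length (take i as) ≡ i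
      ∣take∣≡i = trans (length-take i as) (trans (cong (i ⊓_) ∣as∣≡n) (m≤n⇒m⊓n≡m (<⇒≤ i<n)))

  index-rotate-< : ∀ {q} → i + q < n → index (rotate i as) q ≡ index as (i + q)
  index-rotate-< {q} i+q<n =
    trans (index-++ˡ (drop i as) (take i as) q (subst (q <_) (sym ∣drop∣≡n∸i) q<n∸i)) (index-drop as i q)
    where
      q<n∸i : q < n ∸ i
      q<n∸i = +-cancelˡ-< i q (n ∸ i) (subst (i + q <_) (sym (m+[n∸m]≡n (<⇒≤ i<n))) i+q<n)

  index-rotate-≥ : ∀ {q r} → q < n → n + r ≡ i + q → index (rotate i as) q ≡ index as r
  index-rotate-≥ {q} {r} q<n n+r≡i+q = begin
    index (drop i as ++ take i as) q                        ≡⟨ cong (index (drop i as ++ take i as)) q≡ ⟩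
    index (drop i as ++ take i as) (length (drop i as) + r) ≡⟨ index-++ʳ (drop i as) (take i as) r ⟩
    index (take i as) r                                     ≡⟨ index-take as i r r<i ⟩
    index as r                                              ∎
    where
      open ≡-Reasoning
      r<i : r < i
      r<i = +-cancelˡ-< n r i (subst (_< n + i) (sym n+r≡i+q) (subst (i + q <_) (+-comm i n) (+-monoʳ-< i q<n)))
      q≡ : q ≡ length (drop i as) + r
      q≡ = +-cancelˡ-≡ i q (length (drop i as) + r) (begin
        i + q                        ≡⟨ n+r≡i+q ⟨
        n + r                        ≡⟨ cong (_+ r) (m+[n∸m]≡n (<⇒≤ i<n)) ⟨
        i + (n ∸ i) + r              ≡⟨ +-assoc i (n ∸ i) r ⟩
        i + (n ∸ i + r)              ≡⟨ cong (λ m → i + (m + r)) ∣drop∣≡n∸i ⟨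
        i + (length (drop i as) + r) ∎)

onePeriod-rotate : ∀ {n} {as : List A} {f} i → i < n → Periodic n f → OnePeriod n as f →
                   OnePeriod n (rotate i as) (f ↓ i)
onePeriod-rotate {n = n} {as} {f} i i<n per (∣as∣≡n , idx) = length-rotate ∣as∣≡n i<n , idx′
  where
    idx′ : ∀ q → q < n → index (rotate i as) q ≡ just (f (i + q))
    idx′ q q<n with i + q <? n
    ... | yes i+q<n = trans (index-rotate-< ∣as∣≡n i<n i+q<n) (idx (i + q) i+q<n)
    ... | no i+q≮n with m≤n⇒∃[o]m+o≡n (≮⇒≥ i+q≮n)
    ...   | r , n+r≡i+q = begin
      index (rotate i as) q ≡⟨ index-rotate-≥ ∣as∣≡n i<n q<n n+r≡i+q ⟩
      index as r            ≡⟨ idx r (+-cancelˡ-< n r n (subst (_< n + n) (sym n+r≡i+q) (+-mono-< i<n q<n))) ⟩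
      just (f r)            ≡⟨ cong just (per r) ⟨
      just (f (r + n))      ≡⟨ cong (just ∘ f) (trans (+-comm r n) n+r≡i+q) ⟩
      just (f (i + q))      ∎
      where open ≡-Reasoning

-- The alternating order

module AlternatingOrder {A : Set} {_<ₐ_ : A → A → Set} (sto : IsStrictTotalOrder _≡_ _<ₐ_) where

  open IsStrictTotalOrder sto using (compare) renaming (_≟_ to _≟ₐ_; trans to <ₐ-trans; irrefl to <ₐ-irrefl)

  LessAt : ℕ → (ℕ → A) → (ℕ → A) → Set
  LessAt p f g = (p % 2 ≡ 0 × f p <ₐ g p) ⊎ (p % 2 ≡ 1 × g p <ₐ f p)

  infix 4 _≺_ _≼_

  _≺_ : (ℕ → A) → (ℕ → A) → Set
  f ≺ g = ∃ λ p → AgreeBelow p f g × LessAt p f g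

  _≼_ : (ℕ → A) → (ℕ → A) → Set
  f ≼ g = f ≺ g ⊎ f ≗ g

  lessAt-resp : ∀ {p f f′ g g′} → f p ≡ f′ p → g p ≡ g′ p → LessAt p f g → LessAt p f′ g′
  lessAt-resp ef eg (inj₁ (even , lt)) = inj₁ (even , subst₂ _<ₐ_ ef eg lt)
  lessAt-resp ef eg (inj₂ (odd , lt)) = inj₂ (odd , subst₂ _<ₐ_ eg ef lt)

  lessAt-irrefl : ∀ {p f} → ¬ LessAt p f f
  lessAt-irrefl (inj₁ (_ , lt)) = <ₐ-irrefl refl lt
  lessAt-irrefl (inj₂ (_ , lt)) = <ₐ-irrefl refl lt

  lessAt-trans : ∀ {p f g h} → LessAt p f g → LessAt p g h → LessAt p f h
  lessAt-trans (inj₁ (even , lt)) (inj₁ (_ , lt′)) = inj₁ (even , <ₐ-trans lt lt′)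
  lessAt-trans (inj₂ (odd , lt)) (inj₂ (_ , lt′)) = inj₂ (odd , <ₐ-trans lt′ lt)
  lessAt-trans (inj₁ (even , _)) (inj₂ (odd , _)) = ⊥-elim (0≢1+n (trans (sym even) odd))
  lessAt-trans (inj₂ (odd , _)) (inj₁ (even , _)) = ⊥-elim (0≢1+n (trans (sym even) odd))

  ≺-resp-≗ : ∀ {f f′ g g′} → f ≗ f′ → g ≗ g′ → f ≺ g → f′ ≺ g′
  ≺-resp-≗ {f} {f′} {g} {g′} ef eg (p , ag , lt) =
    p , (λ q q<p → trans (sym (ef q)) (trans (ag q q<p) (eg q))) , lessAt-resp {p} {f} {f′} {g} {g′} (ef p) (eg p) lt

  ≺-irrefl : ∀ {f} → ¬ f ≺ f
  ≺-irrefl {f} (p , _ , lt) = lessAt-irrefl {p} {f} lt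

  ≺-trans : ∀ {f g h} → f ≺ g → g ≺ h → f ≺ h
  ≺-trans {f} {g} {h} (p , ag , lt) (p′ , ag′ , lt′) with <-cmp p p′
  ... | tri< p<p′ _ _ =
    p , agreeBelow-trans ag (agreeBelow-≤ (<⇒≤ p<p′) ag′) , lessAt-resp {p} {f} {f} {g} {h} refl (ag′ p p<p′) lt
  ... | tri≈ _ refl _ = p , agreeBelow-trans ag ag′ , lessAt-trans {p} {f} {g} {h} lt lt′
  ... | tri> _ _ p′<p =
    p′ , agreeBelow-trans (agreeBelow-≤ (<⇒≤ p′<p) ag) ag′ ,
    lessAt-resp {p′} {g} {f} {h} {h} (sym (ag p′ p′<p)) refl lt′

  ≼-trans : ∀ {f g h} → f ≼ g → g ≼ h → f ≼ h
  ≼-trans (inj₁ lt) (inj₁ lt′) = inj₁ (≺-trans lt lt′)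
  ≼-trans (inj₁ lt) (inj₂ eq′) = inj₁ (≺-resp-≗ (λ _ → refl) eq′ lt)
  ≼-trans (inj₂ eq) (inj₁ lt′) = inj₁ (≺-resp-≗ (λ p → sym (eq p)) (λ _ → refl) lt′)
  ≼-trans (inj₂ eq) (inj₂ eq′) = inj₂ (λ p → trans (eq p) (eq′ p))

  ≼-resp-≗ : ∀ {f f′ g g′} → f ≗ f′ → g ≗ g′ → f ≼ g → f′ ≼ g′
  ≼-resp-≗ ef eg (inj₁ lt) = inj₁ (≺-resp-≗ ef eg lt)
  ≼-resp-≗ ef eg (inj₂ eq) = inj₂ (λ p → trans (sym (ef p)) (trans (eq p) (eg p)))

  ≺⇒⋡ : ∀ {f g} → g ≺ f → ¬ f ≼ g
  ≺⇒⋡ gf (inj₁ fg) = ≺-irrefl (≺-trans gf fg)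
  ≺⇒⋡ gf (inj₂ f≗g) = ≺-irrefl (≺-resp-≗ (λ _ → refl) f≗g gf)

  first-mismatch : ∀ f g N → AgreeBelow N f g ⊎ ∃ λ p → AgreeBelow p f g × f p ≢ g p
  first-mismatch f g zero = inj₁ (λ _ ())
  first-mismatch f g (suc N) with first-mismatch f g N
  ... | inj₂ mismatch = inj₂ mismatch
  ... | inj₁ ag with f N ≟ₐ g N
  ...   | yes e = inj₁ (agreeBelow-extend ag e)
  ...   | no ne = inj₂ (N , ag , ne)

  mismatch⇒≺⊎≻ : ∀ {f g} p → AgreeBelow p f g → f p ≢ g p → f ≺ g ⊎ g ≺ f
  mismatch⇒≺⊎≻ {f} {g} p ag ne with compare (f p) (g p) | m%2≡0⊎m%2≡1 p
  ... | tri< lt _ _ | inj₁ even = inj₁ (p , ag , inj₁ (even , lt))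
  ... | tri< lt _ _ | inj₂ odd = inj₂ (p , agreeBelow-sym ag , inj₂ (odd , lt))
  ... | tri≈ _ e _ | _ = ⊥-elim (ne e)
  ... | tri> _ _ gt | inj₁ even = inj₂ (p , agreeBelow-sym ag , inj₁ (even , gt))
  ... | tri> _ _ gt | inj₂ odd = inj₁ (p , ag , inj₂ (odd , gt))

  periodic-≼⊎≻ : ∀ {n} .{{_ : NonZero n}} {f g} → Periodic n f → Periodic n g → f ≼ g ⊎ g ≺ f
  periodic-≼⊎≻ {n} {f = f} {g} per per′ with first-mismatch f g n
  ... | inj₁ ag = inj₁ (inj₂ (periodic-agreeBelow⇒≗ per per′ ag))
  ... | inj₂ (p , ag , ne) with mismatch⇒≺⊎≻ p ag ne
  ...   | inj₁ lt = inj₁ (inj₁ lt)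
  ...   | inj₂ gt = inj₂ gt

  BlockLess : ℕ → (ℕ → A) → (ℕ → A) → Set
  BlockLess k f g = f (k * 2) <ₐ g (k * 2) ⊎ (f (k * 2) ≡ g (k * 2) × g (suc (k * 2)) <ₐ f (suc (k * 2)))

  blockLess⇒≺ : ∀ {f g} k → AgreeBelow (k * 2) f g → BlockLess k f g → f ≺ g
  blockLess⇒≺ k ag (inj₁ lt) = k * 2 , ag , inj₁ (m*n%n≡0 k 2 , lt)
  blockLess⇒≺ k ag (inj₂ (e , gt)) = suc (k * 2) , agreeBelow-extend ag e , inj₂ ([m+kn]%n≡m%n 1 k 2 , gt)

  blockLess-↓-≺ : ∀ {f g} l d → AgreeBelow ((l + d) * 2) f g → BlockLess (l + d) f g →
                  f ↓ (l * 2) ≺ g ↓ (l * 2)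
  blockLess-↓-≺ {f} {g} l d ag bl =
    blockLess⇒≺ d (agreeBelow-↓ (l * 2) (d * 2) (subst (λ m → AgreeBelow m f g) split ag)) (shifted bl)
    where
      split : (l + d) * 2 ≡ l * 2 + d * 2
      split = *-distribʳ-+ 2 l d
      split′ : suc ((l + d) * 2) ≡ l * 2 + suc (d * 2)
      split′ = trans (cong suc split) (sym (+-suc (l * 2) (d * 2)))
      shifted : BlockLess (l + d) f g → BlockLess d (f ↓ (l * 2)) (g ↓ (l * 2))
      shifted (inj₁ lt) = inj₁ (subst₂ _<ₐ_ (cong f split) (cong g split) lt)
      shifted (inj₂ (e , gt)) =
        inj₂ (trans (cong f (sym split)) (trans e (cong g split)) , subst₂ _<ₐ_ (cong g split′) (cong f split′) gt)

  module BlockRotations (σ : ℕ → A) (n : ℕ) .{{_ : NonZero n}} (σ-periodic : Periodic n σ) where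

    rot : ℕ → (ℕ → A)
    rot u = σ ↓ (u * 2)

    rot-periodic : ∀ u → Periodic n (rot u)
    rot-periodic u = periodic-↓ σ-periodic (u * 2)

    rot-↓ : ∀ a l → rot a ↓ (l * 2) ≗ rot (a + l)
    rot-↓ a l p = trans (↓-↓ σ (a * 2) (l * 2) p) (cong (λ m → σ (m + p)) (sym (*-distribʳ-+ 2 a l)))

    rot-% : ∀ u → rot (u % n) ≗ rot u
    rot-% u p = begin
      σ (u % n * 2 + p)                 ≡⟨ periodic-+* σ-periodic _ (u / n * 2) ⟨
      σ (u % n * 2 + p + u / n * 2 * n) ≡⟨ cong σ (regroup (u % n) (u / n) p n) ⟩
      σ ((u % n + u / n * n) * 2 + p)   ≡⟨ cong (λ m → σ (m * 2 + p)) (m≡m%n+[m/n]*n u n) ⟨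
      σ (u * 2 + p)                     ∎
      where
        open ≡-Reasoning
        regroup : ∀ r d p m → r * 2 + p + d * 2 * m ≡ (r + d * m) * 2 + p
        regroup = solve 4 (λ r d p m → r :* con 2 :+ p :+ d :* con 2 :* m := (r :+ d :* m) :* con 2 :+ p) refl

    rot-≗-+ : ∀ {a b} → rot a ≗ rot b → ∀ j → rot (a + j) ≗ rot (b + j)
    rot-≗-+ {a} {b} a≗b j p = trans (sym (rot-↓ a j p)) (trans (a≗b (j * 2 + p)) (rot-↓ b j p))

    Minimal : ℕ → Set
    Minimal a = ∀ u → rot a ≼ rot u

    ≗-minimal : ∀ {a m} → rot a ≗ rot m → Minimal m → Minimal a
    ≗-minimal a≗m min u = ≼-trans (inj₂ a≗m) (min u)

    minimal-below : ∀ N → ∃ λ a → a < suc N × (∀ u → u < suc N → rot a ≼ rot u)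
    minimal-below zero = 0 , s≤s z≤n , λ { zero _ → inj₂ (λ _ → refl) ; (suc u) (s≤s ()) }
    minimal-below (suc N) with minimal-below N
    ... | a , a<1+N , min with periodic-≼⊎≻ (rot-periodic a) (rot-periodic (suc N))
    ...   | inj₁ a≼N = a , m<n⇒m<1+n a<1+N , extend {a} min a≼N
      where
        extend : ∀ {b} → (∀ u → u < suc N → rot b ≼ rot u) → rot b ≼ rot (suc N) →
                 ∀ u → u < suc (suc N) → rot b ≼ rot u
        extend below b≼N u u<2+N with m<1+n⇒m<n∨m≡n u<2+N
        ... | inj₁ u<1+N = below u u<1+N
        ... | inj₂ refl = b≼N
    ...   | inj₂ N≺a = suc N , n<1+n (suc N) , below
      where
        below : ∀ u → u < suc (suc N) → rot (suc N) ≼ rot u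
        below u u<2+N with m<1+n⇒m<n∨m≡n u<2+N
        ... | inj₁ u<1+N = ≼-trans (inj₁ N≺a) (min u u<1+N)
        ... | inj₂ refl = inj₂ (λ _ → refl)

    minimal-exists : ∃ λ a → a < n × Minimal a
    minimal-exists with minimal-below (pred n)
    ... | a , a<n , min = a , subst (a <_) (suc-pred n) a<n , λ u →
      ≼-trans (min (u % n) (subst (u % n <_) (sym (suc-pred n)) (m%n<n u n))) (inj₂ (rot-% u))

    Dominated : ℕ → Set
    Dominated u = ∃ λ s → rot s ≺ rot u

    minimal⇒¬dominated : ∀ {a} → Minimal a → ¬ Dominated a
    minimal⇒¬dominated min (s , s≺a) = ≺⇒⋡ s≺a (min s)

    DominatedBelowExcept : ℕ → ℕ → Set
    DominatedBelowExcept a b = ∀ u → u < a → u ≢ b → Dominated u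

    run-dominated : ∀ {a b k} → AgreeBelow (k * 2) (rot b) (rot a) → BlockLess k (rot b) (rot a) →
                    ∀ u → a ≤ u → u ≤ a + k → Dominated u
    run-dominated {a} {b} {k} ag bl u a≤u u≤a+k with m≤n⇒∃[o]m+o≡n a≤u
    ... | l , refl with m≤n⇒∃[o]m+o≡n (+-cancelˡ-≤ a l k u≤a+k)
    ...   | d , refl = b + l , ≺-resp-≗ (rot-↓ b l) (rot-↓ a l) (blockLess-↓-≺ l d ag bl)

    advance-loser : ∀ {a b k} → DominatedBelowExcept a b → DominatedBelowExcept b a →
                    AgreeBelow (k * 2) (rot b) (rot a) → BlockLess k (rot b) (rot a) →
                    DominatedBelowExcept (a + k + 1) b × DominatedBelowExcept b (a + k + 1)
    advance-loser {a} {b} {k} below-a below-b ag bl = below-a′ , below-b′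
      where
        below-a′ : DominatedBelowExcept (a + k + 1) b
        below-a′ u u<a+k+1 u≢b with u <? a
        ... | yes u<a = below-a u u<a u≢b
        ... | no u≮a =
          run-dominated {a} {b} {k} ag bl u (≮⇒≥ u≮a) (m<1+n⇒m≤n (subst (u <_) (+-comm (a + k) 1) u<a+k+1))
        below-b′ : DominatedBelowExcept b (a + k + 1)
        below-b′ u u<b _ with u ≟ a
        ... | yes refl = run-dominated {a} {b} {k} ag bl u ≤-refl (m≤m+n u k)
        ... | no u≢a = below-b u u<b u≢a

    minimal-below-except : ∀ {a b m} → DominatedBelowExcept b a → m < b → Minimal m → rot a ≗ rot m
    minimal-below-except {a} {m = m} below m<b min with m ≟ a
    ... | yes refl = λ _ → refl
    ... | no m≢a = ⊥-elim (minimal⇒¬dominated {m} min (below m m<b m≢a))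

    -- If rot a ≗ rot b, a minimal m ≥ b has the smaller minimal copy m - (b - a).
    survivor-minimal : ∀ {a b} → a < b → DominatedBelowExcept b a → n ≤ b ⊎ rot a ≗ rot b → Minimal a
    survivor-minimal {a} {b} a<b below periodic = ≗-minimal {a} {m} (rot-a≗ periodic) min
      where
        m = proj₁ minimal-exists
        m<n = proj₁ (proj₂ minimal-exists)
        min = proj₂ (proj₂ minimal-exists)
        descend : rot a ≗ rot b → ∀ f m → m < f → Minimal m → rot a ≗ rot m
        descend a≗b (suc f) m m<1+f min′ with m <? b
        ... | yes m<b = minimal-below-except {a} {b} {m} below m<b min′
        ... | no m≮b with m≤n⇒∃[o]m+o≡n (≮⇒≥ m≮b)
        ...   | j , refl = λ p → trans (descend a≗b f (a + j) a+j<f min″ p) (rot-≗-+ {a} {b} a≗b j p)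
          where
            a+j<f : a + j < f
            a+j<f = <-≤-trans (+-monoˡ-< j a<b) (m<1+n⇒m≤n m<1+f)
            min″ : Minimal (a + j)
            min″ = ≗-minimal {a + j} {b + j} (rot-≗-+ {a} {b} a≗b j) min′
        rot-a≗ : n ≤ b ⊎ rot a ≗ rot b → rot a ≗ rot m
        rot-a≗ (inj₁ n≤b) = minimal-below-except {a} {b} {m} below (<-≤-trans m<n n≤b) min
        rot-a≗ (inj₂ a≗b) = descend a≗b (suc m) m (n<1+n m) min

    advance-collision : ∀ {a} → DominatedBelowExcept a a →
                        DominatedBelowExcept a (a + 1) × DominatedBelowExcept (a + 1) a
    advance-collision {a} below = (λ u u<a _ → below u u<a (<⇒≢ u<a)) , below′
      where
        below′ : DominatedBelowExcept (a + 1) a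
        below′ u u<a+1 u≢a with m<1+n⇒m<n∨m≡n (subst (u <_) (+-comm a 1) u<a+1)
        ... | inj₁ u<a = below u u<a u≢a
        ... | inj₂ u≡a = ⊥-elim (u≢a u≡a)

    record Pointers (u₁ u₂ k : ℕ) : Set where
      field
        below₁   : DominatedBelowExcept u₁ u₂
        below₂   : DominatedBelowExcept u₂ u₁
        distinct : u₁ ≢ u₂
        agree    : AgreeBelow (k * 2) (rot u₁) (rot u₂)
        bound₁   : u₁ ≤ n + n
        bound₂   : u₂ ≤ n + n

    pointers-init : Pointers 0 1 0
    pointers-init = record
      { below₁ = λ _ ()
      ; below₂ = λ { zero _ 0≢0 → ⊥-elim (0≢0 refl) ; (suc _) (s≤s ()) _ }
      ; distinct = λ ()
      ; agree = λ _ ()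
      ; bound₁ = z≤n
      ; bound₂ = ≤-trans (>-nonZero⁻¹ n) (m≤m+n n n)
      }

    pointers-extend : ∀ {u₁ u₂ k} → Pointers u₁ u₂ k → rot u₁ (k * 2) ≡ rot u₂ (k * 2) →
                      rot u₁ (suc (k * 2)) ≡ rot u₂ (suc (k * 2)) → Pointers u₁ u₂ (k + 1)
    pointers-extend {u₁} {u₂} {k} P e e′ = record
      { below₁ = below₁ ; below₂ = below₂ ; distinct = distinct ; bound₁ = bound₁ ; bound₂ = bound₂
      ; agree = subst (λ m → AgreeBelow m (rot u₁) (rot u₂)) (cong (_* 2) (+-comm 1 k))
                      (agreeBelow-extend (agreeBelow-extend agree e) e′)
      }
      where open Pointers P

    pointers-restart : ∀ {a b} → DominatedBelowExcept a b → DominatedBelowExcept b a → a ≢ b →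
                       a ≤ n + n → b ≤ n + n → Pointers a b 0
    pointers-restart below-a below-b a≢b a≤ b≤ = record
      { below₁ = below-a ; below₂ = below-b ; distinct = a≢b ; agree = λ _ () ; bound₁ = a≤ ; bound₂ = b≤ }

    pointers-collide : ∀ {a b} → DominatedBelowExcept a b → a ≡ b → b < n + n → Pointers a (b + 1) 0
    pointers-collide {a} below refl a<n+n =
      pointers-restart below-a below-a+1 (λ a≡a+1 → <⇒≢ (subst (a <_) (+-comm 1 a) (n<1+n a)) a≡a+1)
                       (<⇒≤ a<n+n) (subst (_≤ n + n) (+-comm 1 a) a<n+n)
      where
        below-a = proj₁ (advance-collision below)
        below-a+1 = proj₂ (advance-collision below)

    jump<n+n : ∀ {u k} → u < n → k < n → u + k + 1 < n + n
    jump<n+n {u} {k} u<n k<n =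
      subst (_≤ n + n) (cong suc (sym (trans (+-assoc u k 1) (cong (u +_) (+-comm k 1))))) (+-mono-≤ u<n k<n)

    pointers-exit : ∀ {u₁ u₂ k} → Pointers u₁ u₂ k → n ≤ u₁ ⊎ n ≤ u₂ ⊎ n ≤ k →
                    (u₁ < u₂ → Minimal u₁) × (¬ u₁ < u₂ → Minimal u₂)
    pointers-exit {u₁} {u₂} {k} P exhausted = first , second
      where
        open Pointers P
        u₁≗u₂ : n ≤ k → rot u₁ ≗ rot u₂
        u₁≗u₂ n≤k = periodic-agreeBelow⇒≗ (rot-periodic u₁) (rot-periodic u₂)
                      (agreeBelow-≤ (≤-trans n≤k (m≤m*n k 2)) agree)
        first : u₁ < u₂ → Minimal u₁
        first u₁<u₂ = survivor-minimal u₁<u₂ below₂ (finished exhausted)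
          where
            finished : n ≤ u₁ ⊎ n ≤ u₂ ⊎ n ≤ k → n ≤ u₂ ⊎ rot u₁ ≗ rot u₂
            finished (inj₁ n≤u₁) = inj₁ (≤-trans n≤u₁ (<⇒≤ u₁<u₂))
            finished (inj₂ (inj₁ n≤u₂)) = inj₁ n≤u₂
            finished (inj₂ (inj₂ n≤k)) = inj₂ (u₁≗u₂ n≤k)
        second : ¬ u₁ < u₂ → Minimal u₂
        second u₁≮u₂ = survivor-minimal u₂<u₁ below₁ (finished exhausted)
          where
            u₂<u₁ : u₂ < u₁
            u₂<u₁ = ≤∧≢⇒< (≮⇒≥ u₁≮u₂) (λ e → distinct (sym e))
            finished : n ≤ u₁ ⊎ n ≤ u₂ ⊎ n ≤ k → n ≤ u₁ ⊎ rot u₂ ≗ rot u₁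
            finished (inj₁ n≤u₁) = inj₁ n≤u₁
            finished (inj₂ (inj₁ n≤u₂)) = inj₁ (≤-trans n≤u₂ (<⇒≤ u₂<u₁))
            finished (inj₂ (inj₂ n≤k)) = inj₂ (λ p → sym (u₁≗u₂ n≤k p))

  onePeriod-≺alt : ∀ {m as bs f g} → Periodic (suc m) f → Periodic (suc m) g →
                   OnePeriod (suc m) as f → OnePeriod (suc m) bs g → f ≺ g → Alt._≺alt_ _<ₐ_ as bs
  onePeriod-≺alt {as = []} _ _ (() , _) _ _
  onePeriod-≺alt {as = _ ∷ _} {[]} _ _ _ (() , _) _
  onePeriod-≺alt {as = _ ∷ _} {_ ∷ _} per per′ P P′ f≺g =
    ≺-resp-≗ (λ p → sym (omegaAt-onePeriod per P p)) (λ p → sym (omegaAt-onePeriod per′ P′ p)) f≺g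

  module Word (x : A) (xs : List A) where

    n : ℕ
    n = suc (length xs)

    ω : ℕ → A
    ω = omegaAt x xs

    ω↓-periodic : ∀ r → Periodic n (ω ↓ r)
    ω↓-periodic = periodic-↓ (omegaAt-periodic x xs)

    ω↓-% : ∀ o → ω ↓ (o % n) ≗ ω ↓ o
    ω↓-% o p = begin
      ω (o % n + p)             ≡⟨ periodic-+* (omegaAt-periodic x xs) (o % n + p) (o / n) ⟨
      ω (o % n + p + o / n * n) ≡⟨ cong ω (regroup (o % n) p (o / n * n)) ⟩
      ω (o % n + o / n * n + p) ≡⟨ cong (λ m → ω (m + p)) (m≡m%n+[m/n]*n o n) ⟨
      ω (o + p)                 ∎
      where
        open ≡-Reasoning
        regroup : ∀ r p q → r + p + q ≡ r + q + p
        regroup r p q = trans (+-assoc r p q) (trans (cong (r +_) (+-comm p q)) (sym (+-assoc r q p)))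

    ω-onePeriod : OnePeriod n (x ∷ xs) ω
    ω-onePeriod = refl , λ q q<n → trans (cong (index (x ∷ xs)) (sym (m<n⇒m%n≡m q<n))) (omegaAt-index x xs q)

    GloballyMinimal : ℕ → Set
    GloballyMinimal o = ∀ s → ω ↓ o ≼ ω ↓ s

    globallyMinimal⇒Galois : ∀ o → GloballyMinimal o → Alt.Galois _<ₐ_ (rotate (o % n) (x ∷ xs))
    globallyMinimal⇒Galois o min i _ i<∣W∣ W′≢W =
      galois (≼-resp-≗ (λ p → sym (ω↓-% o p)) (λ _ → refl) (min (r + i)))
      where
        r = o % n
        W = rotate r (x ∷ xs)
        W-period : OnePeriod n W (ω ↓ r)
        W-period = onePeriod-rotate r (m%n<n o n) (omegaAt-periodic x xs) ω-onePeriod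
        W′-period : OnePeriod n (rotate i W) (ω ↓ r ↓ i)
        W′-period = onePeriod-rotate i (subst (i <_) (proj₁ W-period) i<∣W∣) (ω↓-periodic r) W-period
        galois : ω ↓ r ≼ ω ↓ (r + i) → Alt._≺alt_ _<ₐ_ W (rotate i W)
        galois (inj₁ lt) = onePeriod-≺alt (ω↓-periodic r) (periodic-↓ (ω↓-periodic r) i) W-period W′-period
                             (≺-resp-≗ (λ _ → refl) (λ p → sym (↓-↓ ω r i p)) lt)
        galois (inj₂ eq) = ⊥-elim (W′≢W (onePeriod-unique W′-period (proj₁ W-period , λ q q<n →
                             trans (proj₂ W-period q q<n) (cong just (trans (eq q) (sym (↓-↓ ω r i q)))))))

    module Class (c : ℕ) = BlockRotations (ω ↓ c) n (ω↓-periodic c)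

    ClassMinimum : ℕ → ℕ → Set
    ClassMinimum c o = ∀ u → ω ↓ o ≼ ω ↓ (c + u * 2)

    class-minimum : ∀ c a → Class.Minimal c a → ClassMinimum c (c + a * 2)
    class-minimum c a min u = ≼-resp-≗ (↓-↓ ω c (a * 2)) (↓-↓ ω c (u * 2)) (min u)

    minimum-of-class-minima : ∀ {o o₀ o₁} → ClassMinimum 0 o₀ → ClassMinimum 1 o₁ →
                              ω ↓ o ≼ ω ↓ o₀ → ω ↓ o ≼ ω ↓ o₁ → GloballyMinimal o
    minimum-of-class-minima {o} {o₀} {o₁} min₀ min₁ o≼o₀ o≼o₁ s = by-parity (m%2≡0⊎m%2≡1 s)
      where
        s≡ : ∀ {c} → s % 2 ≡ c → c + s / 2 * 2 ≡ s
        s≡ refl = sym (m≡m%n+[m/n]*n s 2)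
        by-parity : s % 2 ≡ 0 ⊎ s % 2 ≡ 1 → ω ↓ o ≼ ω ↓ s
        by-parity (inj₁ even) = ≼-trans o≼o₀ (subst (λ t → ω ↓ o₀ ≼ ω ↓ t) (s≡ even) (min₀ (s / 2)))
        by-parity (inj₂ odd) = ≼-trans o≼o₁ (subst (λ t → ω ↓ o₁ ≼ ω ↓ t) (s≡ odd) (min₁ (s / 2)))

-- The program

rN rOne rZero rC rU₁ rU₂ rK rX₁ rX₂ rP₁ rP₂ rO₀ rO₁ rQ : Fin 14
rN = # 0
rOne = # 1
rC = # 2
rU₁ = # 3
rU₂ = # 4
rK = # 5
rX₁ = # 6
rX₂ = # 7
rP₁ = # 8
rP₂ = # 9
rO₀ = # 10
rO₁ = # 11
rQ = # 12
rZero = # 13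

ℓsearch ℓloop ℓcompare₁ ℓcompare₂ ℓlose₁ ℓlose₂ ℓrestart : ℕ
ℓcollide ℓexit ℓclassDone ℓfinal ℓanswer₀ ℓanswer₁ : ℕ
ℓsearch = 3
ℓloop = 6
ℓcompare₁ = 20
ℓcompare₂ = 25
ℓlose₁ = 28
ℓlose₂ = 31
ℓrestart = 33
ℓcollide = 36
ℓexit = 38
ℓclassDone = 44
ℓfinal = 51
ℓanswer₀ = 68
ℓanswer₁ = 70

-- N = |T|, One = 1, Zero = 0 (never written), C = current parity class, U₁ U₂ K = the two pointers
-- and the number of agreeing blocks, O₀ O₁ = the class winners, Q = index of the final comparison;
-- X₁ X₂ hold positions in T^ω and P₁ P₂ their residues mod N.
-- The number at the end of each line is the address of its first instruction.
program : Program 14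
program =
  len rN ∷ const rOne 1 ∷ const rC 0 ∷                                                  -- 0
  const rU₁ 0 ∷ const rU₂ 1 ∷ const rK 0 ∷                                              -- 3
  jlt rU₁ rN 8 ∷ jmp ℓexit ∷ jlt rU₂ rN 10 ∷ jmp ℓexit ∷ jlt rK rN 12 ∷ jmp ℓexit ∷      -- 6
  add rX₁ rU₁ rK ∷ add rX₁ rX₁ rX₁ ∷ add rX₁ rX₁ rC ∷ mod rP₁ rX₁ rN ∷                   -- 12
  add rX₂ rU₂ rK ∷ add rX₂ rX₂ rX₂ ∷ add rX₂ rX₂ rC ∷ mod rP₂ rX₂ rN ∷                   -- 16
  cmp rP₁ rP₂ ℓlose₂ 21 ℓlose₁ ∷                                                        -- 20
  add rX₁ rX₁ rOne ∷ mod rP₁ rX₁ rN ∷ add rX₂ rX₂ rOne ∷ mod rP₂ rX₂ rN ∷               -- 21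
  cmp rP₁ rP₂ ℓlose₁ 26 ℓlose₂ ∷                                                        -- 25
  add rK rK rOne ∷ jmp ℓloop ∷                                                          -- 26
  add rU₁ rU₁ rK ∷ add rU₁ rU₁ rOne ∷ jmp ℓrestart ∷                                    -- 28
  add rU₂ rU₂ rK ∷ add rU₂ rU₂ rOne ∷                                                   -- 31
  const rK 0 ∷ jeq rU₁ rU₂ ℓcollide ∷ jmp ℓloop ∷                                       -- 33
  add rU₂ rU₂ rOne ∷ jmp ℓloop ∷                                                        -- 36
  jlt rU₁ rU₂ 41 ∷ add rX₁ rU₂ rZero ∷ jmp 42 ∷ add rX₁ rU₁ rZero ∷                     -- 38
  add rX₁ rX₁ rX₁ ∷ add rX₁ rX₁ rC ∷                                                    -- 42
  jeq rC rZero 46 ∷ jmp 49 ∷                                                            -- 44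
  add rO₀ rX₁ rZero ∷ const rC 1 ∷ jmp ℓsearch ∷                                        -- 46
  add rO₁ rX₁ rZero ∷ const rQ 0 ∷                                                      -- 49
  jlt rQ rN 53 ∷ jmp ℓanswer₀ ∷                                                         -- 51
  add rX₁ rO₀ rQ ∷ mod rP₁ rX₁ rN ∷ add rX₂ rO₁ rQ ∷ mod rP₂ rX₂ rN ∷                   -- 53
  cmp rP₁ rP₂ 58 66 62 ∷                                                                -- 57
  add rX₂ rOne rOne ∷ mod rX₁ rQ rX₂ ∷ jeq rX₁ rZero ℓanswer₀ ∷ jmp ℓanswer₁ ∷           -- 58
  add rX₂ rOne rOne ∷ mod rX₁ rQ rX₂ ∷ jeq rX₁ rZero ℓanswer₁ ∷ jmp ℓanswer₀ ∷           -- 62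
  add rQ rQ rOne ∷ jmp ℓfinal ∷                                                         -- 66
  mod rP₁ rO₀ rN ∷ halt rP₁ ∷                                                           -- 68
  mod rP₁ rO₁ rN ∷ halt rP₁ ∷ []                                                        -- 70

block-position : ∀ u k c → u + k + (u + k) + c ≡ c + (u * 2 + k * 2)
block-position = solve 3 (λ u k c → u :+ k :+ (u :+ k) :+ c := c :+ (u :* con 2 :+ k :* con 2)) refl

block-position′ : ∀ u k c → u + k + (u + k) + c + 1 ≡ c + (u * 2 + suc (k * 2))
block-position′ = solve 3 (λ u k c → u :+ k :+ (u :+ k) :+ c :+ con 1 := c :+ (u :* con 2 :+ (con 1 :+ k :* con 2))) refl

exit-position : ∀ a c → a + 0 + (a + 0) + c ≡ c + a * 2
exit-position = solve 2 (λ a c → a :+ con 0 :+ (a :+ con 0) :+ c := c :+ a :* con 2) refl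

-- Running the program

module Execution {A : Set} {_<ₐ_ : A → A → Set} (sto : IsStrictTotalOrder _≡_ _<ₐ_) (x : A) (xs : List A) where

  open IsStrictTotalOrder sto using (compare)
  open AlternatingOrder sto
  open Word x xs
  open Machine sto

  T : List A
  T = x ∷ xs

  B : ℕ
  B = (n + 2) ^ 3

  Bounded : Regs 14 → Set
  Bounded R = ∀ i → R i ≤ B

  Solves : Config 14 → ℕ → Set
  Solves s b = ∃ λ t → ∃ λ o → Runs program T B t s o × t ≤ b × o < n × Alt.Galois _<ₐ_ (rotate o T)

  -- Defs keeps the register update private; executing a `const` recovers it definitionally.
  write : Regs 14 → Fin 14 → ℕ → Regs 14
  write R r v = regsOf (exec [] (cfg 0 R) (const r v))
    where
      regsOf : Result 14 → Regs 14
      regsOf (next s) = Config.regs s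
      regsOf _ = R

  write-bounded : ∀ R r v → Bounded R → v ≤ B → Bounded (write R r v)
  write-bounded R r v bR v≤B i with r Data.Fin.≟ i
  ... | yes _ = v≤B
  ... | no _ = bR i

  solves-step : ∀ {s s′ b} → step program T s ≡ next s′ → RegsBounded B s → Solves s′ b → Solves s (suc b)
  solves-step e bd (t , o , run , t≤b , rest) = suc t , o , go e bd run , s≤s t≤b , rest

  solves-write : ∀ {pc R v b} r → step program T (cfg pc R) ≡ next (cfg (suc pc) (write R r v)) →
                 Bounded R → v ≤ B → (Bounded (write R r v) → Solves (cfg (suc pc) (write R r v)) b) →
                 Solves (cfg pc R) (suc b)
  solves-write {R = R} {v} r e bR v≤B k = solves-step e bR (k (write-bounded R r v bR v≤B))

  solves-mono : ∀ {s b b′} → b ≤ b′ → Solves s b → Solves s b′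
  solves-mono b≤b′ (t , o , run , t≤b , rest) = t , o , run , ≤-trans t≤b b≤b′ , rest

  solves-halt : ∀ {s o} → step program T s ≡ done o → RegsBounded B s → o < n →
                Alt.Galois _<ₐ_ (rotate o T) → Solves s 1
  solves-halt e bd o<n galois = 1 , _ , stop e bd , ≤-refl , o<n , galois

  jlt-taken : ∀ {p a b t} (R : Regs 14) → R a < R b → exec T (cfg p R) (jlt a b t) ≡ next (cfg t R)
  jlt-taken {a = a} {b} R lt with R a <? R b
  ... | yes _ = refl
  ... | no ¬lt = ⊥-elim (¬lt lt)

  jlt-skipped : ∀ {p a b t} (R : Regs 14) → ¬ R a < R b → exec T (cfg p R) (jlt a b t) ≡ next (cfg (suc p) R)
  jlt-skipped {a = a} {b} R ¬lt with R a <? R b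
  ... | yes lt = ⊥-elim (¬lt lt)
  ... | no _ = refl

  jeq-taken : ∀ {p a b t} (R : Regs 14) → R a ≡ R b → exec T (cfg p R) (jeq a b t) ≡ next (cfg t R)
  jeq-taken {a = a} {b} R eq with R a ≟ R b
  ... | yes _ = refl
  ... | no ¬eq = ⊥-elim (¬eq eq)

  jeq-skipped : ∀ {p a b t} (R : Regs 14) → R a ≢ R b → exec T (cfg p R) (jeq a b t) ≡ next (cfg (suc p) R)
  jeq-skipped {a = a} {b} R ¬eq with R a ≟ R b
  ... | yes eq = ⊥-elim (¬eq eq)
  ... | no _ = refl

  module _ (p : ℕ) {a b : Fin 14} {t₁ t₂ t₃ : ℕ} {u v : A} (R : Regs 14)
           (ia : index T (R a) ≡ just u) (ib : index T (R b) ≡ just v) where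

    cmp-< : u <ₐ v → exec T (cfg p R) (cmp a b t₁ t₂ t₃) ≡ next (cfg t₁ R)
    cmp-< lt rewrite ia | ib with compare u v
    ... | tri< _ _ _ = refl
    ... | tri≈ ¬lt _ _ = ⊥-elim (¬lt lt)
    ... | tri> ¬lt _ _ = ⊥-elim (¬lt lt)

    cmp-≡ : u ≡ v → exec T (cfg p R) (cmp a b t₁ t₂ t₃) ≡ next (cfg t₂ R)
    cmp-≡ eq rewrite ia | ib with compare u v
    ... | tri< _ ¬eq _ = ⊥-elim (¬eq eq)
    ... | tri≈ _ _ _ = refl
    ... | tri> _ ¬eq _ = ⊥-elim (¬eq eq)

    cmp-> : v <ₐ u → exec T (cfg p R) (cmp a b t₁ t₂ t₃) ≡ next (cfg t₃ R)
    cmp-> gt rewrite ia | ib with compare u v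
    ... | tri< _ _ ¬gt = ⊥-elim (¬gt gt)
    ... | tri≈ _ _ ¬gt = ⊥-elim (¬gt gt)
    ... | tri> _ _ _ = refl

  exec-mod : ∀ {p m} (R : Regs 14) r a b → R b ≡ suc m →
             exec T (cfg p R) (mod r a b) ≡ next (cfg (suc p) (write R r (R a % suc m)))
  exec-mod R r a b eq rewrite eq = refl

  index-ω : ∀ {v} e → v ≡ e → index T (v % n) ≡ just (ω e)
  index-ω e refl = omegaAt-index x xs e

  -- v ≤ j · n, as a record so that j can be inferred
  record Lin (j v : ℕ) : Set where
    constructor lin
    field
      bound : v ≤ j * n

  lin-≤n : ∀ {v} → v ≤ n → Lin 1 v
  lin-≤n {v} v≤n = lin (subst (v ≤_) (sym (*-identityˡ n)) v≤n)

  lin-< : ∀ {v} → v < n → Lin 1 v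
  lin-< v<n = lin-≤n (<⇒≤ v<n)

  lin-≤1 : ∀ {v} → v ≤ 1 → Lin 1 v
  lin-≤1 v≤1 = lin-≤n (≤-trans v≤1 (s≤s z≤n))

  lin-0 : Lin 0 0
  lin-0 = lin z≤n

  lin-+ : ∀ {i j a b} → Lin i a → Lin j b → Lin (i + j) (a + b)
  lin-+ {i} {j} {a} {b} (lin a≤) (lin b≤) = lin (subst (a + b ≤_) (sym (*-distribʳ-+ n i j)) (+-mono-≤ a≤ b≤))

  lin-≡ : ∀ {j v w} → v ≡ w → Lin j w → Lin j v
  lin-≡ refl l = l

  6n≤B : 6 * n ≤ B
  6n≤B = subst (6 * n ≤_) (sym (expand n)) (m≤m+n (6 * n) _)
    where
      expand : ∀ m → (m + 2) ^ 3 ≡ 6 * m + (m * m * m + 6 * m * m + 6 * m + 8)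
      expand = solve 1 (λ m → (m :+ con 2) :* ((m :+ con 2) :* ((m :+ con 2) :* con 1)) :=
                              con 6 :* m :+ (m :* m :* m :+ con 6 :* m :* m :+ con 6 :* m :+ con 8)) refl

  lin⇒≤B : ∀ {j v} {j≤6 : True (j ≤? 6)} → Lin j v → v ≤ B
  lin⇒≤B {j} {j≤6 = j≤6} (lin v≤) = ≤-trans v≤ (≤-trans (*-monoˡ-≤ n (toWitness j≤6)) 6n≤B)

  solves-mod : ∀ {pc R b m} r a d → R d ≡ suc m → (∀ v → v % suc m ≤ B) →
               step program T (cfg pc R) ≡ exec T (cfg pc R) (mod r a d) → Bounded R →
               (Bounded (write R r (R a % suc m)) → Solves (cfg (suc pc) (write R r (R a % suc m))) b) →
               Solves (cfg pc R) (suc b)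
  solves-mod {R = R} r a d eq bound e bR = solves-write r (trans e (exec-mod R r a d eq)) bR (bound (R a))

  %n≤B : ∀ v → v % n ≤ B
  %n≤B v = lin⇒≤B (lin-< (m%n<n v n))

  %2≤B : ∀ v → v % 2 ≤ B
  %2≤B v = lin⇒≤B (lin-≤1 (m<1+n⇒m≤n (m%n<n v 2)))

  lin-≤n+n : ∀ {v} → v ≤ n + n → Lin 2 v
  lin-≤n+n {v} v≤ = lin (subst (v ≤_) (cong (n +_) (sym (+-identityʳ n))) v≤)

  Frame : ℕ → ℕ → Regs 14 → Set
  Frame c o₀ R = R rN ≡ n × R rOne ≡ 1 × R rZero ≡ 0 × R rC ≡ c × R rO₀ ≡ o₀

  AfterClass : ℕ → ℕ → ℕ → Set
  AfterClass c o₀ K = ∀ {R} a → Frame c o₀ R → R rX₁ ≡ c + a * 2 → Bounded R →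
                      Class.Minimal c a → a ≤ n + n → Solves (cfg ℓclassDone R) K

  module Search (c o₀ K : ℕ) (c≤1 : c ≤ 1) (finish : AfterClass c o₀ K) where

    open Class c

    Cursor : ℕ → ℕ → ℕ → Regs 14 → Set
    Cursor u₁ u₂ k R = R rU₁ ≡ u₁ × R rU₂ ≡ u₂ × R rK ≡ k

    LoopBudget : ℕ → ℕ
    LoopBudget f = 30 * f + 10 + K

    Fuel : ℕ → ℕ → ℕ → ℕ → Set
    Fuel u₁ u₂ k f = 3 * n ≤ u₁ + u₂ + k + f

    class-lin : ∀ {R} → Frame c o₀ R → Lin 1 (R rC)
    class-lin (_ , _ , _ , eC , _) = lin-≡ eC (lin-≤1 c≤1)

    fuel-step : ∀ {s s′ f} → 3 * n ≤ s + suc f → suc s ≤ s′ → 3 * n ≤ s′ + f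
    fuel-step {s} {s′} {f} fuel s<s′ = ≤-trans fuel (subst (_≤ s′ + f) (sym (+-suc s f)) (+-monoˡ-≤ f s<s′))

    fuel-exhausted : ∀ {u₁ u₂ k} → u₁ < n → u₂ < n → k < n → ¬ Fuel u₁ u₂ k 0
    fuel-exhausted {u₁} {u₂} {k} u₁<n u₂<n k<n =
      <⇒≱ (subst₂ _<_ (sym (+-identityʳ _)) 3n (+-mono-< (+-mono-< u₁<n u₂<n) k<n))
      where
        3n : n + n + n ≡ 3 * n
        3n = solve 1 (λ m → m :+ m :+ m := con 3 :* m) refl n

    exit-tail : ∀ {R a} → Frame c o₀ R → R rX₁ ≡ a + 0 → Bounded R → Minimal a → a ≤ n + n →
                Solves (cfg 42 R) (2 + K)
    exit-tail {R} {a} fr@(_ , _ , _ , eC , _) eX bR min a≤ =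
      solves-write rX₁ refl bR (lin⇒≤B doubled-lin) λ bR′ →
      solves-write rX₁ refl bR′ (lin⇒≤B (lin-+ doubled-lin (class-lin {R} fr))) λ bR″ →
      finish a fr (trans (cong₂ _+_ (cong₂ _+_ eX eX) eC) (exit-position a c)) bR″ min a≤
      where
        a-lin : Lin 2 (R rX₁)
        a-lin = lin-≡ eX (lin-+ (lin-≤n+n a≤) lin-0)
        doubled-lin : Lin 4 (R rX₁ + R rX₁)
        doubled-lin = lin-+ a-lin a-lin

    exit-block : ∀ {R u₁ u₂ k} → Frame c o₀ R → Cursor u₁ u₂ k R → Bounded R → Pointers u₁ u₂ k →
                 n ≤ u₁ ⊎ n ≤ u₂ ⊎ n ≤ k → Solves (cfg ℓexit R) (5 + K)
    exit-block {R} {u₁} {u₂} fr@(_ , _ , eZ , _) (eU₁ , eU₂ , _) bR P exhausted with u₁ <? u₂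
    ... | yes u₁<u₂ =
      solves-mono (n≤1+n _)
        (solves-step (jlt-taken R (subst₂ _<_ (sym eU₁) (sym eU₂) u₁<u₂)) bR
        (solves-write rX₁ refl bR (lin⇒≤B (lin-≡ (cong₂ _+_ eU₁ eZ) (lin-+ (lin-≤n+n bound₁) lin-0))) λ bR′ →
         exit-tail fr (cong₂ _+_ eU₁ eZ) bR′ (proj₁ (pointers-exit P exhausted) u₁<u₂) bound₁))
      where open Pointers P
    ... | no u₁≮u₂ =
      solves-step (jlt-skipped R (λ lt → u₁≮u₂ (subst₂ _<_ eU₁ eU₂ lt))) bR
        (solves-write rX₁ refl bR (lin⇒≤B (lin-≡ (cong₂ _+_ eU₂ eZ) (lin-+ (lin-≤n+n bound₂) lin-0))) λ bR′ →
         solves-step refl bR′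
         (exit-tail fr (cong₂ _+_ eU₂ eZ) bR′ (proj₂ (pointers-exit P exhausted) u₁≮u₂) bound₂))
      where open Pointers P

    exit-budget : ∀ s f {s≤4 : True (s ≤? 4)} → s + (5 + K) ≤ LoopBudget f
    exit-budget s f {s≤4} =
      ≤-trans (+-monoˡ-≤ (5 + K) (toWitness s≤4)) (+-monoˡ-≤ K (≤-trans (n≤1+n 9) (m≤n+m 10 (30 * f))))

    body-budget : ∀ f → 24 + LoopBudget f ≤ LoopBudget (suc f)
    body-budget f = subst (24 + LoopBudget f ≤_) (sym (expand f K)) (m≤n+m _ 6)
      where
        expand : ∀ f K → 30 * suc f + 10 + K ≡ 6 + (24 + (30 * f + 10 + K))
        expand = solve 2 (λ f K → con 30 :* (con 1 :+ f) :+ con 10 :+ K := con 6 :+ (con 24 :+ (con 30 :* f :+ con 10 :+ K))) refl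

    loop : ∀ f {R u₁ u₂ k} → Frame c o₀ R → Cursor u₁ u₂ k R → Bounded R → Pointers u₁ u₂ k →
           Fuel u₁ u₂ k f → Solves (cfg ℓloop R) (LoopBudget f)

    body : ∀ f {R u₁ u₂ k} → Frame c o₀ R → Cursor u₁ u₂ k R → Bounded R → Pointers u₁ u₂ k →
           Fuel u₁ u₂ k f → u₁ < n → u₂ < n → k < n → Solves (cfg ℓloop R) (LoopBudget f)

    compare₁ : ∀ f {R u₁ u₂ k} → Frame c o₀ R → Cursor u₁ u₂ k R →
               R rX₁ ≡ u₁ + k + (u₁ + k) + c → R rX₂ ≡ u₂ + k + (u₂ + k) + c →
               index T (R rP₁) ≡ just (rot u₁ (k * 2)) → index T (R rP₂) ≡ just (rot u₂ (k * 2)) →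
               Bounded R → Pointers u₁ u₂ k → Fuel u₁ u₂ k (suc f) → u₁ < n → u₂ < n → k < n →
               Solves (cfg ℓcompare₁ R) (13 + LoopBudget f)

    compare₂ : ∀ f {R u₁ u₂ k} → Frame c o₀ R → Cursor u₁ u₂ k R →
               index T (R rP₁) ≡ just (rot u₁ (suc (k * 2))) → index T (R rP₂) ≡ just (rot u₂ (suc (k * 2))) →
               Bounded R → Pointers u₁ u₂ k → rot u₁ (k * 2) ≡ rot u₂ (k * 2) → Fuel u₁ u₂ k (suc f) →
               u₁ < n → u₂ < n → k < n → Solves (cfg ℓcompare₂ R) (8 + LoopBudget f)

    lose₁ : ∀ f {R u₁ u₂ k} → Frame c o₀ R → Cursor u₁ u₂ k R → Bounded R → Pointers u₁ u₂ k →
            BlockLess k (rot u₂) (rot u₁) → Fuel u₁ u₂ k (suc f) → u₁ < n → k < n →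
            Solves (cfg ℓlose₁ R) (7 + LoopBudget f)

    lose₂ : ∀ f {R u₁ u₂ k} → Frame c o₀ R → Cursor u₁ u₂ k R → Bounded R → Pointers u₁ u₂ k →
            BlockLess k (rot u₁) (rot u₂) → Fuel u₁ u₂ k (suc f) → u₂ < n → k < n →
            Solves (cfg ℓlose₂ R) (7 + LoopBudget f)

    restart : ∀ f {R a b} → Frame c o₀ R → R rU₁ ≡ a → R rU₂ ≡ b → Bounded R →
              DominatedBelowExcept a b → DominatedBelowExcept b a → a ≤ n + n → b ≤ n + n →
              (a ≡ b → b < n + n) → Fuel a b 0 f → Solves (cfg ℓrestart R) (4 + LoopBudget f)

    loop f {R} {u₁} {u₂} {k} fr@(eN , _) cur@(eU₁ , eU₂ , eK) bR P fuel with u₁ <? n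
    ... | no u₁≮n =
      solves-mono (exit-budget 2 f)
        (solves-step (jlt-skipped R (λ lt → u₁≮n (subst₂ _<_ eU₁ eN lt))) bR
        (solves-step refl bR (exit-block fr cur bR P (inj₁ (≮⇒≥ u₁≮n)))))
    ... | yes u₁<n with u₂ <? n
    ...   | no u₂≮n =
      solves-mono (exit-budget 3 f)
        (solves-step (jlt-taken R (subst₂ _<_ (sym eU₁) (sym eN) u₁<n)) bR
        (solves-step (jlt-skipped R (λ lt → u₂≮n (subst₂ _<_ eU₂ eN lt))) bR
        (solves-step refl bR (exit-block fr cur bR P (inj₂ (inj₁ (≮⇒≥ u₂≮n)))))))
    ...   | yes u₂<n with k <? n
    ...     | no k≮n =
      solves-mono (exit-budget 4 f)
        (solves-step (jlt-taken R (subst₂ _<_ (sym eU₁) (sym eN) u₁<n)) bR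
        (solves-step (jlt-taken R (subst₂ _<_ (sym eU₂) (sym eN) u₂<n)) bR
        (solves-step (jlt-skipped R (λ lt → k≮n (subst₂ _<_ eK eN lt))) bR
        (solves-step refl bR (exit-block fr cur bR P (inj₂ (inj₂ (≮⇒≥ k≮n))))))))
    ...     | yes k<n = body f fr cur bR P fuel u₁<n u₂<n k<n

    body zero _ _ _ _ fuel u₁<n u₂<n k<n = ⊥-elim (fuel-exhausted u₁<n u₂<n k<n fuel)
    body (suc f) {R} {u₁} {u₂} {k} fr@(eN , _ , _ , eC , _) cur@(eU₁ , eU₂ , eK) bR P fuel u₁<n u₂<n k<n =
      solves-mono (body-budget f)
      (solves-step (jlt-taken R (subst₂ _<_ (sym eU₁) (sym eN) u₁<n)) bR
      (solves-step (jlt-taken R (subst₂ _<_ (sym eU₂) (sym eN) u₂<n)) bR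
      (solves-step (jlt-taken R (subst₂ _<_ (sym eK) (sym eN) k<n)) bR
      (solves-write rX₁ refl bR (lin⇒≤B sum₁) λ bR₁ →
       solves-write rX₁ refl bR₁ (lin⇒≤B (lin-+ sum₁ sum₁)) λ bR₂ →
       solves-write rX₁ refl bR₂ (lin⇒≤B (lin-+ (lin-+ sum₁ sum₁) (class-lin {R} fr))) λ bR₃ →
       solves-mod rP₁ rX₁ rN eN %n≤B refl bR₃ λ bR₄ →
       solves-write rX₂ refl bR₄ (lin⇒≤B sum₂) λ bR₅ →
       solves-write rX₂ refl bR₅ (lin⇒≤B (lin-+ sum₂ sum₂)) λ bR₆ →
       solves-write rX₂ refl bR₆ (lin⇒≤B (lin-+ (lin-+ sum₂ sum₂) (class-lin {R} fr))) λ bR₇ →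
       solves-mod rP₂ rX₂ rN eN %n≤B refl bR₇ λ bR₈ →
       compare₁ f fr cur x₁ x₂
         (index-ω (c + (u₁ * 2 + k * 2)) (trans x₁ (block-position u₁ k c)))
         (index-ω (c + (u₂ * 2 + k * 2)) (trans x₂ (block-position u₂ k c)))
         bR₈ P fuel u₁<n u₂<n k<n))))
      where
        sum₁ : Lin 2 (R rU₁ + R rK)
        sum₁ = lin-≡ (cong₂ _+_ eU₁ eK) (lin-+ (lin-< u₁<n) (lin-< k<n))
        sum₂ : Lin 2 (R rU₂ + R rK)
        sum₂ = lin-≡ (cong₂ _+_ eU₂ eK) (lin-+ (lin-< u₂<n) (lin-< k<n))
        x₁ : R rU₁ + R rK + (R rU₁ + R rK) + R rC ≡ u₁ + k + (u₁ + k) + c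
        x₁ = cong₂ _+_ (cong₂ _+_ (cong₂ _+_ eU₁ eK) (cong₂ _+_ eU₁ eK)) eC
        x₂ : R rU₂ + R rK + (R rU₂ + R rK) + R rC ≡ u₂ + k + (u₂ + k) + c
        x₂ = cong₂ _+_ (cong₂ _+_ (cong₂ _+_ eU₂ eK) (cong₂ _+_ eU₂ eK)) eC

    compare₁ f {R} {u₁} {u₂} {k} fr@(eN , eOne , _) cur eX₁ eX₂ i₁ i₂ bR P fuel u₁<n u₂<n k<n
      with compare (rot u₁ (k * 2)) (rot u₂ (k * 2))
    ... | tri< lt _ _ =
      solves-mono (m≤n+m _ 5) (solves-step (cmp-< ℓcompare₁ R i₁ i₂ lt) bR (lose₂ f fr cur bR P (inj₁ lt) fuel u₂<n k<n))
    ... | tri> _ _ gt =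
      solves-mono (m≤n+m _ 5) (solves-step (cmp-> ℓcompare₁ R i₁ i₂ gt) bR (lose₁ f fr cur bR P (inj₁ gt) fuel u₁<n k<n))
    ... | tri≈ _ eq _ =
      solves-step (cmp-≡ ℓcompare₁ R i₁ i₂ eq) bR
      (solves-write rX₁ refl bR (lin⇒≤B (next-lin eX₁ u₁<n)) λ bR₁ →
       solves-mod rP₁ rX₁ rN eN %n≤B refl bR₁ λ bR₂ →
       solves-write rX₂ refl bR₂ (lin⇒≤B (next-lin eX₂ u₂<n)) λ bR₃ →
       solves-mod rP₂ rX₂ rN eN %n≤B refl bR₃ λ bR₄ →
       compare₂ f fr cur
         (index-ω (c + (u₁ * 2 + suc (k * 2))) (trans (cong₂ _+_ eX₁ eOne) (block-position′ u₁ k c)))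
         (index-ω (c + (u₂ * 2 + suc (k * 2))) (trans (cong₂ _+_ eX₂ eOne) (block-position′ u₂ k c)))
         bR₄ P eq fuel u₁<n u₂<n k<n)
      where
        next-lin : ∀ {r u} → R r ≡ u + k + (u + k) + c → u < n → Lin 6 (R r + R rOne)
        next-lin {u = u} eX u<n = lin-≡ (cong₂ _+_ eX eOne)
          (lin-+ (lin-+ (lin-+ uk uk) (lin-≤1 c≤1)) (lin-≤1 ≤-refl))
          where
            uk : Lin 2 (u + k)
            uk = lin-+ (lin-< u<n) (lin-< k<n)

    compare₂ f {R} {u₁} {u₂} {k} fr@(_ , eOne , _) cur@(eU₁ , eU₂ , eK) i₁ i₂ bR P eq fuel u₁<n u₂<n k<n
      with compare (rot u₁ (suc (k * 2))) (rot u₂ (suc (k * 2)))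
    ... | tri< lt _ _ =
      solves-step (cmp-< ℓcompare₂ R i₁ i₂ lt) bR (lose₁ f fr cur bR P (inj₂ (sym eq , lt)) fuel u₁<n k<n)
    ... | tri> _ _ gt =
      solves-step (cmp-> ℓcompare₂ R i₁ i₂ gt) bR (lose₂ f fr cur bR P (inj₂ (eq , gt)) fuel u₂<n k<n)
    ... | tri≈ _ eq′ _ =
      solves-mono (m≤n+m _ 5)
      (solves-step (cmp-≡ ℓcompare₂ R i₁ i₂ eq′) bR
      (solves-write rK refl bR (lin⇒≤B (lin-≡ (cong₂ _+_ eK eOne) (lin-≤n k+1≤n))) λ bR′ →
       solves-step refl bR′
       (loop f fr (eU₁ , eU₂ , cong₂ _+_ eK eOne) bR′ (pointers-extend P eq eq′) (fuel-step fuel (≤-reflexive grown)))))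
      where
        k+1≤n : k + 1 ≤ n
        k+1≤n = subst (_≤ n) (+-comm 1 k) k<n
        grown : suc (u₁ + u₂ + k) ≡ u₁ + u₂ + (k + 1)
        grown = solve 3 (λ a b k → con 1 :+ (a :+ b :+ k) := a :+ b :+ (k :+ con 1)) refl u₁ u₂ k

    lose₁ f {R} {u₁} {u₂} {k} fr@(_ , eOne , _) (eU₁ , eU₂ , eK) bR P beaten fuel u₁<n k<n =
      solves-write rU₁ refl bR (lin⇒≤B (lin-≡ (cong₂ _+_ eU₁ eK) (lin-+ (lin-< u₁<n) (lin-< k<n)))) λ bR₁ →
      solves-write rU₁ refl bR₁ (lin⇒≤B (lin-≡ jumped (lin-≤n+n (<⇒≤ jump<)))) λ bR₂ →
      solves-step refl bR₂
      (restart f fr jumped eU₂ bR₂ (proj₁ loser) (proj₂ loser) (<⇒≤ jump<) bound₂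
        (λ e → subst (_< n + n) e jump<) (fuel-step fuel (≤-reflexive grown)))
      where
        open Pointers P
        jumped : R rU₁ + R rK + R rOne ≡ u₁ + k + 1
        jumped = cong₂ _+_ (cong₂ _+_ eU₁ eK) eOne
        jump< : u₁ + k + 1 < n + n
        jump< = jump<n+n u₁<n k<n
        loser = advance-loser below₁ below₂ (agreeBelow-sym agree) beaten
        grown : suc (u₁ + u₂ + k) ≡ u₁ + k + 1 + u₂ + 0
        grown = solve 3 (λ a b k → con 1 :+ (a :+ b :+ k) := a :+ k :+ con 1 :+ b :+ con 0) refl u₁ u₂ k

    lose₂ f {R} {u₁} {u₂} {k} fr@(_ , eOne , _) (eU₁ , eU₂ , eK) bR P beaten fuel u₂<n k<n =
      solves-mono (n≤1+n _)
      (solves-write rU₂ refl bR (lin⇒≤B (lin-≡ (cong₂ _+_ eU₂ eK) (lin-+ (lin-< u₂<n) (lin-< k<n)))) λ bR₁ →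
       solves-write rU₂ refl bR₁ (lin⇒≤B (lin-≡ jumped (lin-≤n+n (<⇒≤ jump<)))) λ bR₂ →
       restart f fr eU₁ jumped bR₂ (proj₂ loser) (proj₁ loser) bound₁ (<⇒≤ jump<)
         (λ _ → jump<) (fuel-step fuel (≤-reflexive grown)))
      where
        open Pointers P
        jumped : R rU₂ + R rK + R rOne ≡ u₂ + k + 1
        jumped = cong₂ _+_ (cong₂ _+_ eU₂ eK) eOne
        jump< : u₂ + k + 1 < n + n
        jump< = jump<n+n u₂<n k<n
        loser = advance-loser below₂ below₁ agree beaten
        grown : suc (u₁ + u₂ + k) ≡ u₁ + (u₂ + k + 1) + 0
        grown = solve 3 (λ a b k → con 1 :+ (a :+ b :+ k) := a :+ (b :+ k :+ con 1) :+ con 0) refl u₁ u₂ k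

    restart f {R} {a} {b} fr@(_ , eOne , _) eU₁ eU₂ bR below-a below-b a≤ b≤ collision fuel with a ≟ b
    ... | yes a≡b =
      solves-write rK refl bR z≤n λ bR₁ →
      solves-step (jeq-taken _ (trans eU₁ (trans a≡b (sym eU₂)))) bR₁
      (solves-write rU₂ refl bR₁ (lin⇒≤B (lin-≡ (cong₂ _+_ eU₂ eOne) (lin-≤n+n b+1≤))) λ bR₂ →
       solves-step refl bR₂
       (loop f fr (eU₁ , cong₂ _+_ eU₂ eOne , refl) bR₂ (pointers-collide below-a a≡b (collision a≡b))
         (≤-trans fuel (+-monoˡ-≤ f (+-monoˡ-≤ 0 (+-monoʳ-≤ a (m≤m+n b 1)))))))
      where
        b+1≤ : b + 1 ≤ n + n
        b+1≤ = subst (_≤ n + n) (+-comm 1 b) (collision a≡b)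
    ... | no a≢b =
      solves-mono (n≤1+n _)
      (solves-write rK refl bR z≤n λ bR₁ →
       solves-step (jeq-skipped _ (λ e → a≢b (trans (sym eU₁) (trans e eU₂)))) bR₁
       (solves-step refl bR₁ (loop f fr (eU₁ , eU₂ , refl) bR₁ (pointers-restart below-a below-b a≢b a≤ b≤) fuel)))

    search : ∀ {R} → Frame c o₀ R → Bounded R → Solves (cfg ℓsearch R) (3 + LoopBudget (3 * n))
    search fr bR =
      solves-write rU₁ refl bR z≤n λ bR₁ →
      solves-write rU₂ refl bR₁ (lin⇒≤B (lin-≤1 ≤-refl)) λ bR₂ →
      solves-write rK refl bR₂ z≤n λ bR₃ →
      loop (3 * n) fr (refl , refl , refl) bR₃ pointers-init (m≤n+m (3 * n) 1)

  FinalFrame : ℕ → ℕ → Regs 14 → Set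
  FinalFrame o₀ o₁ R = R rN ≡ n × R rOne ≡ 1 × R rZero ≡ 0 × R rO₀ ≡ o₀ × R rO₁ ≡ o₁

  even-register : ∀ {v z q} → v ≡ q → z ≡ 0 → q % 2 ≡ 0 → v % 2 ≡ z
  even-register v≡q z≡0 even = trans (cong (_% 2) v≡q) (trans even (sym z≡0))

  odd-register : ∀ {v z q} → v ≡ q → z ≡ 0 → q % 2 ≡ 1 → v % 2 ≢ z
  odd-register v≡q z≡0 odd e with trans (sym odd) (trans (cong (_% 2) (sym v≡q)) (trans e z≡0))
  ... | ()

  module Final (o₀ o₁ : ℕ) (min₀ : ClassMinimum 0 o₀) (min₁ : ClassMinimum 1 o₁)
               (o₀-lin : Lin 5 o₀) (o₁-lin : Lin 5 o₁) where

    answer₀ : ∀ {R} → FinalFrame o₀ o₁ R → Bounded R → ω ↓ o₀ ≼ ω ↓ o₁ → Solves (cfg ℓanswer₀ R) 2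
    answer₀ {R} (eN , _ , _ , eO₀ , _) bR o₀≼o₁ =
      solves-mod rP₁ rO₀ rN eN %n≤B refl bR λ bR′ →
      solves-halt refl bR′ (m%n<n (R rO₀) n)
        (subst (λ o → Alt.Galois _<ₐ_ (rotate (o % n) T)) (sym eO₀)
          (globallyMinimal⇒Galois o₀ (minimum-of-class-minima {o₀} {o₀} {o₁} min₀ min₁
                                        (inj₂ (λ _ → refl)) o₀≼o₁)))

    answer₁ : ∀ {R} → FinalFrame o₀ o₁ R → Bounded R → ω ↓ o₁ ≼ ω ↓ o₀ → Solves (cfg ℓanswer₁ R) 2
    answer₁ {R} (eN , _ , _ , _ , eO₁) bR o₁≼o₀ =
      solves-mod rP₁ rO₁ rN eN %n≤B refl bR λ bR′ →
      solves-halt refl bR′ (m%n<n (R rO₁) n)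
        (subst (λ o → Alt.Galois _<ₐ_ (rotate (o % n) T)) (sym eO₁)
          (globallyMinimal⇒Galois o₁ (minimum-of-class-minima {o₁} {o₀} {o₁} min₀ min₁
                                        o₁≼o₀ (inj₂ (λ _ → refl)))))

    two≤B : ∀ {R} → FinalFrame o₀ o₁ R → R rOne + R rOne ≤ B
    two≤B (_ , eOne , _) = lin⇒≤B (lin-≡ (cong₂ _+_ eOne eOne) (lin-+ (lin-≤1 ≤-refl) (lin-≤1 ≤-refl)))

    o₀-smaller-at : ∀ {R q} → FinalFrame o₀ o₁ R → R rQ ≡ q → Bounded R → AgreeBelow q (ω ↓ o₀) (ω ↓ o₁) →
                    ω (o₀ + q) <ₐ ω (o₁ + q) → Solves (cfg 58 R) 6
    o₀-smaller-at {R} {q} fr@(_ , eOne , eZ , _) eQ bR agree lt with m%2≡0⊎m%2≡1 q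
    ... | inj₁ even =
      solves-write rX₂ refl bR (two≤B {R} fr) λ bR₁ →
      solves-mod rX₁ rQ rX₂ (cong₂ _+_ eOne eOne) %2≤B refl bR₁ λ bR₂ →
      solves-mono (n≤1+n _) (solves-step (jeq-taken _ (even-register eQ eZ even)) bR₂
        (answer₀ fr bR₂ (inj₁ (q , agree , inj₁ (even , lt)))))
    ... | inj₂ odd =
      solves-write rX₂ refl bR (two≤B {R} fr) λ bR₁ →
      solves-mod rX₁ rQ rX₂ (cong₂ _+_ eOne eOne) %2≤B refl bR₁ λ bR₂ →
      solves-step (jeq-skipped _ (odd-register eQ eZ odd)) bR₂
        (solves-step refl bR₂ (answer₁ fr bR₂ (inj₁ (q , agreeBelow-sym agree , inj₂ (odd , lt)))))

    o₁-smaller-at : ∀ {R q} → FinalFrame o₀ o₁ R → R rQ ≡ q → Bounded R → AgreeBelow q (ω ↓ o₀) (ω ↓ o₁) →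
                    ω (o₁ + q) <ₐ ω (o₀ + q) → Solves (cfg 62 R) 6
    o₁-smaller-at {R} {q} fr@(_ , eOne , eZ , _) eQ bR agree gt with m%2≡0⊎m%2≡1 q
    ... | inj₁ even =
      solves-write rX₂ refl bR (two≤B {R} fr) λ bR₁ →
      solves-mod rX₁ rQ rX₂ (cong₂ _+_ eOne eOne) %2≤B refl bR₁ λ bR₂ →
      solves-mono (n≤1+n _) (solves-step (jeq-taken _ (even-register eQ eZ even)) bR₂
        (answer₁ fr bR₂ (inj₁ (q , agreeBelow-sym agree , inj₁ (even , gt)))))
    ... | inj₂ odd =
      solves-write rX₂ refl bR (two≤B {R} fr) λ bR₁ →
      solves-mod rX₁ rQ rX₂ (cong₂ _+_ eOne eOne) %2≤B refl bR₁ λ bR₂ →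
      solves-step (jeq-skipped _ (odd-register eQ eZ odd)) bR₂
        (solves-step refl bR₂ (answer₀ fr bR₂ (inj₁ (q , agree , inj₂ (odd , gt)))))

    decided : ∀ f → 7 ≤ 3 + (8 * f + 12)
    decided f = ≤-trans (m≤m+n 7 8) (+-monoʳ-≤ 3 (m≤n+m 12 (8 * f)))

    final-loop : ∀ f {R q} → FinalFrame o₀ o₁ R → R rQ ≡ q → Bounded R →
                 AgreeBelow q (ω ↓ o₀) (ω ↓ o₁) → n ≤ q + f → Solves (cfg ℓfinal R) (8 * f + 12)

    final-body : ∀ f {R q} → FinalFrame o₀ o₁ R → R rQ ≡ q → Bounded R →
                 AgreeBelow q (ω ↓ o₀) (ω ↓ o₁) → n ≤ q + f → q < n → Solves (cfg ℓfinal R) (8 * f + 12)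

    final-compare : ∀ f {R q} → FinalFrame o₀ o₁ R → R rQ ≡ q →
                    index T (R rP₁) ≡ just (ω (o₀ + q)) → index T (R rP₂) ≡ just (ω (o₁ + q)) → Bounded R →
                    AgreeBelow q (ω ↓ o₀) (ω ↓ o₁) → n ≤ q + suc f → q < n → Solves (cfg 57 R) (3 + (8 * f + 12))

    final-loop f {R} {q} fr@(eN , _) eQ bR agree fuel with q <? n
    ... | no q≮n =
      solves-mono (≤-trans (m≤m+n 4 8) (m≤n+m 12 (8 * f)))
        (solves-step (jlt-skipped R (λ lt → q≮n (subst₂ _<_ eQ eN lt))) bR
        (solves-step refl bR (answer₀ fr bR (inj₂ o₀≗o₁))))
      where
        o₀≗o₁ : ω ↓ o₀ ≗ ω ↓ o₁
        o₀≗o₁ = periodic-agreeBelow⇒≗ (ω↓-periodic o₀) (ω↓-periodic o₁) (agreeBelow-≤ (≮⇒≥ q≮n) agree)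
    ... | yes q<n = final-body f fr eQ bR agree fuel q<n

    final-body zero {q = q} _ _ _ _ fuel q<n = ⊥-elim (<⇒≱ q<n (subst (n ≤_) (+-identityʳ q) fuel))
    final-body (suc f) {R} {q} fr@(eN , _ , _ , eO₀ , eO₁) eQ bR agree fuel q<n =
      solves-mono (≤-reflexive (cong (_+ 12) (sym (*-suc 8 f))))
      (solves-step (jlt-taken R (subst₂ _<_ (sym eQ) (sym eN) q<n)) bR
      (solves-write rX₁ refl bR (lin⇒≤B (lin-≡ (cong₂ _+_ eO₀ eQ) (lin-+ o₀-lin (lin-< q<n)))) λ bR₁ →
       solves-mod rP₁ rX₁ rN eN %n≤B refl bR₁ λ bR₂ →
       solves-write rX₂ refl bR₂ (lin⇒≤B (lin-≡ (cong₂ _+_ eO₁ eQ) (lin-+ o₁-lin (lin-< q<n)))) λ bR₃ →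
       solves-mod rP₂ rX₂ rN eN %n≤B refl bR₃ λ bR₄ →
       final-compare f fr eQ (index-ω (o₀ + q) (cong₂ _+_ eO₀ eQ)) (index-ω (o₁ + q) (cong₂ _+_ eO₁ eQ))
         bR₄ agree fuel q<n))

    final-compare f {R} {q} fr@(_ , eOne , _) eQ i₁ i₂ bR agree fuel q<n with compare (ω (o₀ + q)) (ω (o₁ + q))
    ... | tri< lt _ _ =
      solves-mono (decided f) (solves-step (cmp-< 57 R i₁ i₂ lt) bR (o₀-smaller-at fr eQ bR agree lt))
    ... | tri> _ _ gt =
      solves-mono (decided f) (solves-step (cmp-> 57 R i₁ i₂ gt) bR (o₁-smaller-at fr eQ bR agree gt))
    ... | tri≈ _ eq _ =
      solves-step (cmp-≡ 57 R i₁ i₂ eq) bR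
      (solves-write rQ refl bR (lin⇒≤B (lin-≡ (cong₂ _+_ eQ eOne) (lin-≤n (subst (_≤ n) (+-comm 1 q) q<n)))) λ bR′ →
       solves-step refl bR′
       (final-loop f fr (cong₂ _+_ eQ eOne) bR′ (subst (λ m → AgreeBelow m (ω ↓ o₀) (ω ↓ o₁)) (+-comm 1 q) (agreeBelow-extend agree eq))
         (subst (n ≤_) (trans (+-suc q f) (cong (_+ f) (+-comm 1 q))) fuel)))

  class-position-lin : ∀ {c a} → c ≤ 1 → a ≤ n + n → Lin 5 (c + a * 2)
  class-position-lin {a = a} c≤1 a≤ =
    lin-+ (lin-≤1 c≤1) (lin-≡ (trans (*-comm a 2) (cong (a +_) (+-identityʳ a))) (lin-+ (lin-≤n+n a≤) (lin-≤n+n a≤)))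

  FinalBudget : ℕ
  FinalBudget = 4 + (8 * n + 12)

  after-class₁ : ∀ {o₀} → ClassMinimum 0 o₀ → Lin 5 o₀ → AfterClass 1 o₀ FinalBudget
  after-class₁ {o₀} min₀ o₀-lin {R} a (eN , eOne , eZ , eC , eO₀) eX bR min a≤ =
    solves-step (jeq-skipped _ (λ e → 1≢0 (trans (sym eC) (trans e eZ)))) bR
    (solves-step refl bR
    (solves-write rO₁ refl bR (lin⇒≤B (lin-≡ o₁-reg (class-position-lin ≤-refl a≤))) λ bR₁ →
     solves-write rQ refl bR₁ z≤n λ bR₂ →
     Final.final-loop o₀ (1 + a * 2) min₀ (class-minimum 1 a min) o₀-lin (class-position-lin ≤-refl a≤)
       n (eN , eOne , eZ , eO₀ , o₁-reg) refl bR₂ (λ _ ()) ≤-refl))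
    where
      1≢0 : 1 ≢ 0
      1≢0 ()
      o₁-reg : R rX₁ + R rZero ≡ 1 + a * 2
      o₁-reg = trans (cong₂ _+_ eX eZ) (+-identityʳ (1 + a * 2))

  SearchBudget : ℕ → ℕ
  SearchBudget K = 3 + (30 * (3 * n) + 10 + K)

  after-class₀ : AfterClass 0 0 (4 + SearchBudget FinalBudget)
  after-class₀ {R} a (eN , eOne , eZ , eC , _) eX bR min a≤ =
    solves-step (jeq-taken _ (trans eC (sym eZ))) bR
    (solves-write rO₀ refl bR (lin⇒≤B (lin-≡ o₀-reg (class-position-lin z≤n a≤))) λ bR₁ →
     solves-write rC refl bR₁ (lin⇒≤B (lin-≤1 ≤-refl)) λ bR₂ →
     solves-step refl bR₂
     (Search.search 1 (a * 2) FinalBudget ≤-refl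
       (after-class₁ (class-minimum 0 a min) (class-position-lin z≤n a≤)) (eN , eOne , eZ , refl , o₀-reg) bR₂))
    where
      o₀-reg : R rX₁ + R rZero ≡ a * 2
      o₀-reg = trans (cong₂ _+_ eX eZ) (+-identityʳ (a * 2))

  run : Solves (cfg 0 (λ _ → 0)) (188 * n + 49)
  run =
    solves-mono (≤-reflexive (total n))
    (solves-write rN refl (λ _ → z≤n) (lin⇒≤B (lin-≤n ≤-refl)) λ bR₁ →
     solves-write rOne refl bR₁ (lin⇒≤B (lin-≤1 ≤-refl)) λ bR₂ →
     solves-write rC refl bR₂ z≤n λ bR₃ →
     Search.search 0 0 (4 + SearchBudget FinalBudget) z≤n after-class₀ (refl , refl , refl , refl , refl) bR₃)
    where
      total : ∀ m → 3 + (3 + (30 * (3 * m) + 10 + (4 + (3 + (30 * (3 * m) + 10 + (4 + (8 * m + 12))))))) ≡ 188 * m + 49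
      total = solve 1 (λ m → con 3 :+ (con 3 :+ (con 30 :* (con 3 :* m) :+ con 10 :+ (con 4 :+ (con 3 :+
                (con 30 :* (con 3 :* m) :+ con 10 :+ (con 4 :+ (con 8 :* m :+ con 12))))))) := con 188 :* m :+ con 49) refl

theorem36 : (A : Set) (_<ₐ_ : A → A → Set) (sto : IsStrictTotalOrder _≡_ _<ₐ_) →
    Σ ℕ λ k → Σ (Program k) λ P → ∃ λ a → ∃ λ b → ∃ λ e →
      (T : List A) → Primitive T →
        ∃ λ t → ∃ λ o →
          Machine.Runs sto P T ((length T + 2) ^ e) t initial o
          × t ≤ a * length T + b
          × o < length T
          × Alt.Galois _<ₐ_ (rotate o T)
theorem36 A _<ₐ_ sto = 14 , program , 188 , 49 , 3 , solves
  where
    -- Primitivity only rules out the empty word: Galois already exempts rotations equal to the word.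
    solves : (T : List A) → Primitive T →
             ∃ λ t → ∃ λ o → Machine.Runs sto program T ((length T + 2) ^ 3) t initial o
             × t ≤ 188 * length T + 49 × o < length T × Alt.Galois _<ₐ_ (rotate o T)
    solves [] prim = ⊥-elim (prim [] 2 (s≤s (s≤s z≤n)) refl)
    solves (x ∷ xs) _ = Execution.run sto x xs
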